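{- If a connected simple graph $G$ has two pendant vertices at distance greater than $3$, then there exists a simple graph $G'$ with the same degree sequence as $G$ such that $G'$ has exactly two components, one of which is an isolated edge (a component isomorphic to $K_2$).
   Context: A pendant vertex is a vertex of degree $1$. The distance between two vertices is the number of edges in a shortest path between them. -}

module Defs where

open import Data.Nat using (ℕ; zero; suc; _<_)
open import Data.Fin using (Fin)
open import Data.Bool using (Bool; true; false; if_then_else_)
open import Data.List using (List; map; allFin)
open import Data.Nat.ListAction using (sum)
open import Data.List.Relation.Binary.Permutation.Propositional using (_↭_)
open import Data.Product using (Σ; ∃; _×_; _,_)
open import Relation.Binary.PropositionalEquality using (_≡_)
open import Relation.Nullary using (¬_)

record SimpleGraph (n : ℕ) : Set where
  field
    adj       : Fin n → Fin n → Bool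
    symmetric : ∀ u v → adj u v ≡ adj v u
    loopless  : ∀ v → adj v v ≡ false

open SimpleGraph public

Adj : ∀ {n} → SimpleGraph n → Fin n → Fin n → Set
Adj G u v = adj G u v ≡ true

degree : ∀ {n} → SimpleGraph n → Fin n → ℕ
degree {n} G v = sum (map (λ w → if adj G v w then 1 else 0) (allFin n))

-- degree sequence (as a list, compared up to permutation = as a multiset)
degreeSequence : ∀ {n} → SimpleGraph n → List ℕ
degreeSequence {n} G = map (degree G) (allFin n)

Pendant : ∀ {n} → SimpleGraph n → Fin n → Set
Pendant G v = degree G v ≡ 1

data Walk {n : ℕ} (G : SimpleGraph n) : Fin n → Fin n → ℕ → Set where
  nil  : ∀ {v} → Walk G v v zero
  cons : ∀ {u w v k} → Adj G u w → Walk G w v k → Walk G u v (suc k)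

Reachable : ∀ {n} → SimpleGraph n → Fin n → Fin n → Set
Reachable G u v = ∃ λ k → Walk G u v k

Connected : ∀ {n} → SimpleGraph n → Set
Connected {n} G = ∀ (u v : Fin n) → Reachable G u v

-- dist(u,v) > d : every walk (hence every shortest path) from u to v
-- has length > d (includes the case that v is unreachable).
DistGreaterThan : ∀ {n} → SimpleGraph n → Fin n → Fin n → ℕ → Set
DistGreaterThan G u v d = ∀ k → Walk G u v k → d < k

IsolatedEdge : ∀ {n} → SimpleGraph n → Fin n → Fin n → Set
IsolatedEdge {n} G u v =
  Adj G u v × (∀ w → Adj G u w → w ≡ v) × (∀ w → Adj G v w → w ≡ u)

-- G has exactly two components, one of which is the isolated edge {u,v}:
-- {u,v} is a component, the remaining vertex set is nonempty, and
-- any two remaining vertices lie in the same component.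
TwoComponentsOneIsolatedEdge : ∀ {n} → SimpleGraph n → Set
TwoComponentsOneIsolatedEdge {n} G =
  Σ (Fin n) λ u → Σ (Fin n) λ v →
    IsolatedEdge G u v
    × (Σ (Fin n) λ w → ¬ w ≡ u × ¬ w ≡ v)
    × (∀ x y → ¬ x ≡ u → ¬ x ≡ v → ¬ y ≡ u → ¬ y ≡ v → Reachable G x y)

-- Let a and b be the neighbours of the pendant vertices p and q.  Since
-- dist(p,q) > 3, the vertices p, q, a, b are distinct and pq, ab are
-- non-edges, so the 2-switch replacing the edges pa, qb by pq, ab keeps every
-- degree.  Afterwards pq is an isolated edge, and the rest stays connected: a
-- walk of G between two other vertices can only visit a pendant vertex on a
-- detour a → p → a, which can be cut out.
module Submission where

open import Defs
open import Data.Nat using (ℕ; zero; suc; _+_; _≤_; z≤n; s≤s)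
open import Data.Nat.Properties using (+-suc; 1+n≰n; <⇒≱; ≤-refl)
open import Data.Fin using (Fin; zero; suc; _≟_)
open import Data.Bool using (Bool; true; false; if_then_else_; _∧_; _∨_)
open import Data.Bool.Properties using (∧-comm; ∧-zeroʳ; ∨-comm; ∨-identityʳ; ∨-zeroʳ; ¬-not)
open import Data.List using (map; allFin)
open import Data.List.Properties using (map-cong; map-tabulate)
open import Data.Nat.ListAction using (sum)
open import Data.List.Relation.Binary.Permutation.Propositional using (_↭_; ↭-reflexive)
open import Data.Vec.Functional using (updateAt)
open import Data.Vec.Functional.Properties using (updateAt-updates; updateAt-minimal)
open import Data.Product using (Σ; ∃; _×_; _,_; proj₂)
import Data.Product as Prod
open import Data.Empty using (⊥)
open import Function using (_∘_; id; const)
open import Relation.Nullary using (¬_; Dec; yes; no; does; contradiction)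
open import Relation.Nullary.Decidable using (dec-true; dec-false)
open import Relation.Binary.PropositionalEquality
  using (_≡_; _≢_; _≗_; refl; sym; trans; cong; cong₂; subst; ≢-sym; module ≡-Reasoning)

open ≡-Reasoning

indicator : Bool → ℕ
indicator b = if b then 1 else 0

count : ∀ {n} → (Fin n → Bool) → ℕ
count {n} f = sum (map (indicator ∘ f) (allFin n))

count-cong : ∀ {n} {f g : Fin n → Bool} → f ≗ g → count f ≡ count g
count-cong {n} f≗g = cong sum (map-cong (cong indicator ∘ f≗g) (allFin n))

count-suc : ∀ {n} (f : Fin (suc n) → Bool) →
            count f ≡ indicator (f zero) + count (f ∘ suc)
count-suc f = cong (indicator (f zero) +_)
  (cong sum (trans (map-tabulate suc (indicator ∘ f)) (sym (map-tabulate id (indicator ∘ f ∘ suc)))))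

count-clear : ∀ {n} (f : Fin n → Bool) {x} → f x ≡ true →
              count f ≡ suc (count (updateAt f x (const false)))
count-clear f {zero} fx = begin
  count f                                     ≡⟨ count-suc f ⟩
  indicator (f zero) + count (f ∘ suc)        ≡⟨ cong (λ b → indicator b + count (f ∘ suc)) fx ⟩
  suc (count (f ∘ suc))                       ≡⟨ cong suc (count-suc (updateAt f zero (const false))) ⟨
  suc (count (updateAt f zero (const false))) ∎
count-clear f {suc x} fx = begin
  count f                                        ≡⟨ count-suc f ⟩
  indicator (f zero) + count (f ∘ suc)           ≡⟨ cong (indicator (f zero) +_) (count-clear (f ∘ suc) fx) ⟩
  indicator (f zero) + suc (count f∘suc-cleared) ≡⟨ +-suc _ _ ⟩
  suc (indicator (f zero) + count f∘suc-cleared) ≡⟨ cong suc (count-suc (updateAt f (suc x) (const false))) ⟨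
  suc (count (updateAt f (suc x) (const false))) ∎
  where
  f∘suc-cleared : Fin _ → Bool
  f∘suc-cleared = updateAt (f ∘ suc) x (const false)

count-exchange : ∀ {n} (f g : Fin n → Bool) {x y} →
                 f x ≡ true → f y ≡ false → g x ≡ false → g y ≡ true →
                 (∀ w → w ≢ x → w ≢ y → f w ≡ g w) → count f ≡ count g
count-exchange f g {x} {y} fx fy gx gy agree = begin
  count f                                  ≡⟨ count-clear f fx ⟩
  suc (count (updateAt f x (const false))) ≡⟨ cong suc (count-cong cleared) ⟩
  suc (count (updateAt g y (const false))) ≡⟨ count-clear g gy ⟨
  count g                                  ∎
  where
  x≢y : x ≢ y
  x≢y refl = contradiction (trans (sym fx) fy) λ ()
  cleared : updateAt f x (const false) ≗ updateAt g y (const false)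
  cleared w with w ≟ x | w ≟ y
  ... | yes refl | _ = trans (updateAt-updates x f) (sym (trans (updateAt-minimal x y g x≢y) gx))
  ... | no w≢x | yes refl = trans (trans (updateAt-minimal y x f w≢x) fy) (sym (updateAt-updates y g))
  ... | no w≢x | no w≢y = trans (updateAt-minimal w x f w≢x)
                            (trans (agree w w≢x w≢y) (sym (updateAt-minimal w y g w≢y)))

2≤count : ∀ {n} (f : Fin n → Bool) {x y} → f x ≡ true → f y ≡ true → x ≢ y → 2 ≤ count f
2≤count f {x} {y} fx fy x≢y
  rewrite count-clear f fx
        | count-clear (updateAt f x (const false)) (trans (updateAt-minimal y x f (≢-sym x≢y)) fy)
        = s≤s (s≤s z≤n)

Adj-sym : ∀ {n} (G : SimpleGraph n) {u v} → Adj G u v → Adj G v u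
Adj-sym G {u} {v} u~v = trans (symmetric G v u) u~v

Adj-irrefl : ∀ {n} (G : SimpleGraph n) {u v} → Adj G u v → u ≢ v
Adj-irrefl G {u} u~u refl = contradiction (trans (sym u~u) (loopless G u)) λ ()

pendant-neighbour-unique : ∀ {n} (G : SimpleGraph n) {v x y} →
                           Pendant G v → Adj G v x → Adj G v y → x ≡ y
pendant-neighbour-unique G {v} {x} {y} pendant v~x v~y with x ≟ y
... | yes x≡y = x≡y
... | no x≢y = contradiction (subst (2 ≤_) pendant (2≤count (adj G v) v~x v~y x≢y)) 1+n≰n

reachable⇒neighbour : ∀ {n} (G : SimpleGraph n) {u v} → Reachable G u v → u ≢ v → ∃ (Adj G u)
reachable⇒neighbour G (_ , nil) u≢u = contradiction refl u≢u
reachable⇒neighbour G (_ , cons {w = w} u~w _) _ = w , u~w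

DistGreaterThan⇒≢ : ∀ {n} (G : SimpleGraph n) {u v d} → DistGreaterThan G u v d → u ≢ v
DistGreaterThan⇒≢ G far refl = <⇒≱ (far 0 nil) z≤n

edge : ∀ {n} → Fin n → Fin n → Fin n → Fin n → Bool
edge x y u v = (does (u ≟ x) ∧ does (v ≟ y)) ∨ (does (u ≟ y) ∧ does (v ≟ x))

edge-sym : ∀ {n} (x y u v : Fin n) → edge x y u v ≡ edge x y v u
edge-sym x y u v = trans (∨-comm (does (u ≟ x) ∧ does (v ≟ y)) _)
  (cong₂ _∨_ (∧-comm (does (u ≟ y)) _) (∧-comm (does (u ≟ x)) _))

edge-comm : ∀ {n} (x y u v : Fin n) → edge x y u v ≡ edge y x u v
edge-comm x y u v = ∨-comm (does (u ≟ x) ∧ does (v ≟ y)) _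

edge-refl : ∀ {n} (x y : Fin n) → edge x y x y ≡ true
edge-refl x y rewrite dec-true (x ≟ x) refl | dec-true (y ≟ y) refl = refl

edge-∉ : ∀ {n} {x y u : Fin n} v → u ≢ x → u ≢ y → edge x y u v ≡ false
edge-∉ {x = x} {y} {u} v u≢x u≢y rewrite dec-false (u ≟ x) u≢x | dec-false (u ≟ y) u≢y = refl

edge-∌ʳ : ∀ {n} {x y u v : Fin n} → u ≢ y → v ≢ y → edge x y u v ≡ false
edge-∌ʳ {x = x} {y} {u} {v} u≢y v≢y rewrite dec-false (u ≟ y) u≢y | dec-false (v ≟ y) v≢y =
  trans (∨-identityʳ _) (∧-zeroʳ _)

edge-∌ˡ : ∀ {n} {x y u v : Fin n} → u ≢ x → v ≢ x → edge x y u v ≡ false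
edge-∌ˡ {x = x} {y} {u} {v} u≢x v≢x = trans (edge-comm x y u v) (edge-∌ʳ u≢x v≢x)

edge-loop : ∀ {n} {x y : Fin n} v → x ≢ y → edge x y v v ≡ false
edge-loop {x = x} {y} v x≢y = by-cases (v ≟ x)
  where
  by-cases : Dec (v ≡ x) → edge x y v v ≡ false
  by-cases (yes v≡x) = edge-∌ʳ (x≢y ∘ trans (sym v≡x)) (x≢y ∘ trans (sym v≡x))
  by-cases (no v≢x) = edge-∌ˡ v≢x v≢x

record Switchable {n} (G : SimpleGraph n) (x₁ y₁ x₂ y₂ : Fin n) : Set where
  field
    x₁~y₁ : Adj G x₁ y₁
    x₂~y₂ : Adj G x₂ y₂
    x₁≁x₂ : ¬ Adj G x₁ x₂
    y₁≁y₂ : ¬ Adj G y₁ y₂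
    x₁≢x₂ : x₁ ≢ x₂
    y₁≢y₂ : y₁ ≢ y₂

  x₁≢y₁ : x₁ ≢ y₁
  x₁≢y₁ = Adj-irrefl G x₁~y₁

  x₂≢y₂ : x₂ ≢ y₂
  x₂≢y₂ = Adj-irrefl G x₂~y₂

  y₁≢x₂ : y₁ ≢ x₂
  y₁≢x₂ y₁≡x₂ = x₁≁x₂ (subst (Adj G x₁) y₁≡x₂ x₁~y₁)

  x₁≢y₂ : x₁ ≢ y₂
  x₁≢y₂ x₁≡y₂ = x₁≁x₂ (Adj-sym G (subst (Adj G x₂) (sym x₁≡y₂) x₂~y₂))

Switchable-swap : ∀ {n} {G : SimpleGraph n} {x₁ y₁ x₂ y₂} →
                  Switchable G x₁ y₁ x₂ y₂ → Switchable G x₂ y₂ x₁ y₁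
Switchable-swap {G = G} s = record
  { x₁~y₁ = x₂~y₂
  ; x₂~y₂ = x₁~y₁
  ; x₁≁x₂ = x₁≁x₂ ∘ Adj-sym G
  ; y₁≁y₂ = y₁≁y₂ ∘ Adj-sym G
  ; x₁≢x₂ = ≢-sym x₁≢x₂
  ; y₁≢y₂ = ≢-sym y₁≢y₂
  }
  where open Switchable s

Switchable-flip : ∀ {n} {G : SimpleGraph n} {x₁ y₁ x₂ y₂} →
                  Switchable G x₁ y₁ x₂ y₂ → Switchable G y₁ x₁ y₂ x₂
Switchable-flip {G = G} s = record
  { x₁~y₁ = Adj-sym G x₁~y₁
  ; x₂~y₂ = Adj-sym G x₂~y₂
  ; x₁≁x₂ = y₁≁y₂
  ; y₁≁y₂ = x₁≁x₂
  ; x₁≢x₂ = y₁≢y₂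
  ; y₁≢y₂ = x₁≢x₂
  }
  where open Switchable s

switchAdj : ∀ {n} → SimpleGraph n → (x₁ y₁ x₂ y₂ : Fin n) → Fin n → Fin n → Bool
switchAdj G x₁ y₁ x₂ y₂ u v =
  if edge x₁ y₁ u v ∨ edge x₂ y₂ u v then false else (edge x₁ x₂ u v ∨ edge y₁ y₂ u v) ∨ adj G u v

switchAdj-swap : ∀ {n} (G : SimpleGraph n) (x₁ y₁ x₂ y₂ u v : Fin n) →
                 switchAdj G x₁ y₁ x₂ y₂ u v ≡ switchAdj G x₂ y₂ x₁ y₁ u v
switchAdj-swap G x₁ y₁ x₂ y₂ u v
  rewrite ∨-comm (edge x₁ y₁ u v) (edge x₂ y₂ u v) | edge-comm x₁ x₂ u v | edge-comm y₁ y₂ u v = refl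

switchAdj-flip : ∀ {n} (G : SimpleGraph n) (x₁ y₁ x₂ y₂ u v : Fin n) →
                 switchAdj G x₁ y₁ x₂ y₂ u v ≡ switchAdj G y₁ x₁ y₂ x₂ u v
switchAdj-flip G x₁ y₁ x₂ y₂ u v
  rewrite edge-comm x₁ y₁ u v | edge-comm x₂ y₂ u v | ∨-comm (edge x₁ x₂ u v) (edge y₁ y₂ u v) = refl

switch : ∀ {n} {G : SimpleGraph n} {x₁ y₁ x₂ y₂} → Switchable G x₁ y₁ x₂ y₂ → SimpleGraph n
switch {G = G} {x₁} {y₁} {x₂} {y₂} s = record
  { adj = switchAdj G x₁ y₁ x₂ y₂
  ; symmetric = sym-switch
  ; loopless = loopless-switch
  }
  where
  open Switchable s
  sym-switch : ∀ u v → switchAdj G x₁ y₁ x₂ y₂ u v ≡ switchAdj G x₁ y₁ x₂ y₂ v u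
  sym-switch u v rewrite edge-sym x₁ y₁ u v | edge-sym x₂ y₂ u v | edge-sym x₁ x₂ u v
                       | edge-sym y₁ y₂ u v | symmetric G u v = refl
  loopless-switch : ∀ v → switchAdj G x₁ y₁ x₂ y₂ v v ≡ false
  loopless-switch v rewrite edge-loop v x₁≢y₁ | edge-loop v x₂≢y₂ | edge-loop v x₁≢x₂
                          | edge-loop v y₁≢y₂ = loopless G v

module _ {n} {G : SimpleGraph n} {x₁ y₁ x₂ y₂} (s : Switchable G x₁ y₁ x₂ y₂) where
  open Switchable s

  switch-removes : adj (switch s) x₁ y₁ ≡ false
  switch-removes rewrite edge-refl x₁ y₁ = refl

  switch-adds : Adj (switch s) x₁ x₂
  switch-adds rewrite edge-∌ʳ {x = x₁} x₁≢y₁ (≢-sym y₁≢x₂) | edge-∉ x₂ x₁≢x₂ x₁≢y₂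
                    | edge-refl x₁ x₂ = refl

  switch-agrees-at-x₁ : ∀ {w} → w ≢ y₁ → w ≢ x₂ → adj (switch s) x₁ w ≡ adj G x₁ w
  switch-agrees-at-x₁ {w} w≢y₁ w≢x₂
    rewrite edge-∌ʳ {x = x₁} x₁≢y₁ w≢y₁ | edge-∉ w x₁≢x₂ x₁≢y₂
          | edge-∌ʳ {x = x₁} x₁≢x₂ w≢x₂ | edge-∉ w x₁≢y₁ x₁≢y₂ = refl

  switch-agrees-off : ∀ {u} → u ≢ x₁ → u ≢ y₁ → u ≢ x₂ → u ≢ y₂ → adj (switch s) u ≗ adj G u
  switch-agrees-off u≢x₁ u≢y₁ u≢x₂ u≢y₂ w
    rewrite edge-∉ w u≢x₁ u≢y₁ | edge-∉ w u≢x₂ u≢y₂ | edge-∉ w u≢x₁ u≢x₂ | edge-∉ w u≢y₁ u≢y₂ = refl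

  switch-keeps : ∀ {u v} → u ≢ x₁ → u ≢ x₂ → v ≢ x₁ → v ≢ x₂ → Adj G u v → Adj (switch s) u v
  switch-keeps u≢x₁ u≢x₂ v≢x₁ v≢x₂ u~v
    rewrite edge-∌ˡ {y = y₁} u≢x₁ v≢x₁ | edge-∌ˡ {y = y₂} u≢x₂ v≢x₂ | u~v = ∨-zeroʳ _

  degree-switch-x₁ : degree (switch s) x₁ ≡ degree G x₁
  degree-switch-x₁ = count-exchange (adj (switch s) x₁) (adj G x₁)
    switch-adds switch-removes (¬-not x₁≁x₂) x₁~y₁
    (λ w w≢x₂ w≢y₁ → switch-agrees-at-x₁ w≢y₁ w≢x₂)

  switch-isolates-x₁ : Pendant G x₁ → ∀ w → Adj (switch s) x₁ w → w ≡ x₂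
  switch-isolates-x₁ x₁-pendant w x₁~w = by-cases (w ≟ x₂) (w ≟ y₁)
    where
    by-cases : Dec (w ≡ x₂) → Dec (w ≡ y₁) → w ≡ x₂
    by-cases (yes w≡x₂) _ = w≡x₂
    by-cases (no _) (yes w≡y₁) =
      contradiction (trans (sym (subst (Adj (switch s) x₁) w≡y₁ x₁~w)) switch-removes) λ ()
    by-cases (no w≢x₂) (no w≢y₁) = contradiction (pendant-neighbour-unique G x₁-pendant
      (trans (sym (switch-agrees-at-x₁ w≢y₁ w≢x₂)) x₁~w) x₁~y₁) w≢y₁

degree-switch : ∀ {n} {G : SimpleGraph n} {x₁ y₁ x₂ y₂} (s : Switchable G x₁ y₁ x₂ y₂) →
                ∀ v → degree (switch s) v ≡ degree G v
degree-switch {G = G} {x₁} {y₁} {x₂} {y₂} s v = by-cases (v ≟ x₁) (v ≟ x₂) (v ≟ y₁) (v ≟ y₂)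
  where
  swap≗ : ∀ u → adj (switch s) u ≗ adj (switch (Switchable-swap s)) u
  swap≗ = switchAdj-swap G x₁ y₁ x₂ y₂
  flip≗ : ∀ u → adj (switch s) u ≗ adj (switch (Switchable-flip s)) u
  flip≗ = switchAdj-flip G x₁ y₁ x₂ y₂
  by-cases : Dec (v ≡ x₁) → Dec (v ≡ x₂) → Dec (v ≡ y₁) → Dec (v ≡ y₂) →
             degree (switch s) v ≡ degree G v
  by-cases (yes refl) _ _ _ = degree-switch-x₁ s
  by-cases _ (yes refl) _ _ = trans (count-cong (swap≗ v)) (degree-switch-x₁ (Switchable-swap s))
  by-cases _ _ (yes refl) _ = trans (count-cong (flip≗ v)) (degree-switch-x₁ (Switchable-flip s))
  by-cases _ _ _ (yes refl) =
    trans (count-cong (λ w → trans (flip≗ v w) (switchAdj-swap G y₁ x₁ y₂ x₂ v w)))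
          (degree-switch-x₁ (Switchable-swap (Switchable-flip s)))
  by-cases (no v≢x₁) (no v≢x₂) (no v≢y₁) (no v≢y₂) =
    count-cong (switch-agrees-off s v≢x₁ v≢y₁ v≢x₂ v≢y₂)

degreeSequence-switch : ∀ {n} {G : SimpleGraph n} {x₁ y₁ x₂ y₂} (s : Switchable G x₁ y₁ x₂ y₂) →
                        degreeSequence (switch s) ≡ degreeSequence G
degreeSequence-switch {n} s = map-cong (degree-switch s) (allFin n)

module _ {n} {G : SimpleGraph n} {x₁ y₁ x₂ y₂} (s : Switchable G x₁ y₁ x₂ y₂)
         (x₁-pendant : Pendant G x₁) (x₂-pendant : Pendant G x₂) where
  open Switchable s

  switch-isolatedEdge : IsolatedEdge (switch s) x₁ x₂
  switch-isolatedEdge =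
    switch-adds s ,
    switch-isolates-x₁ s x₁-pendant ,
    λ w x₂~w → switch-isolates-x₁ (Switchable-swap s) x₂-pendant w
                 (trans (sym (switchAdj-swap G x₁ y₁ x₂ y₂ x₂ w)) x₂~w)

  switch-reachable : ∀ {u v k} → Walk G u v k → u ≢ x₁ → u ≢ x₂ → v ≢ x₁ → v ≢ x₂ →
                     Reachable (switch s) u v
  switch-reachable nil _ _ _ _ = 0 , nil
  switch-reachable (cons {w = w} u~w w⇝v) u≢x₁ u≢x₂ v≢x₁ v≢x₂ with w ≟ x₁ | w ≟ x₂
  switch-reachable (cons u~w nil) _ _ v≢x₁ _ | yes refl | _ = contradiction refl v≢x₁
  switch-reachable (cons u~w (cons w~z z⇝v)) u≢x₁ u≢x₂ v≢x₁ v≢x₂ | yes refl | _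
    with refl ← pendant-neighbour-unique G x₁-pendant (Adj-sym G u~w) w~z =
    switch-reachable z⇝v u≢x₁ u≢x₂ v≢x₁ v≢x₂
  switch-reachable (cons u~w nil) _ _ _ v≢x₂ | no _ | yes refl = contradiction refl v≢x₂
  switch-reachable (cons u~w (cons w~z z⇝v)) u≢x₁ u≢x₂ v≢x₁ v≢x₂ | no _ | yes refl
    with refl ← pendant-neighbour-unique G x₂-pendant (Adj-sym G u~w) w~z =
    switch-reachable z⇝v u≢x₁ u≢x₂ v≢x₁ v≢x₂
  switch-reachable (cons u~w w⇝v) u≢x₁ u≢x₂ v≢x₁ v≢x₂ | no w≢x₁ | no w≢x₂ =
    Prod.map suc (cons (switch-keeps s u≢x₁ u≢x₂ w≢x₁ w≢x₂ u~w))
      (switch-reachable w⇝v w≢x₁ w≢x₂ v≢x₁ v≢x₂)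

  switch-twoComponentsOneIsolatedEdge : Connected G → TwoComponentsOneIsolatedEdge (switch s)
  switch-twoComponentsOneIsolatedEdge connected =
    x₁ , x₂ , switch-isolatedEdge , (y₁ , ≢-sym x₁≢y₁ , y₁≢x₂) ,
    λ u v u≢x₁ u≢x₂ v≢x₁ v≢x₂ → switch-reachable (proj₂ (connected u v)) u≢x₁ u≢x₂ v≢x₁ v≢x₂

DistGreaterThan3⇒Switchable : ∀ {n} {G : SimpleGraph n} {p a q b} →
  Adj G p a → Adj G q b → DistGreaterThan G p q 3 → Switchable G p a q b
DistGreaterThan3⇒Switchable {G = G} {p} {a} {q} {b} p~a q~b far = record
  { x₁~y₁ = p~a
  ; x₂~y₂ = q~b
  ; x₁≁x₂ = λ p~q → tooShort (cons p~q nil) (s≤s z≤n)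
  ; y₁≁y₂ = λ a~b → tooShort (cons p~a (cons a~b (cons (Adj-sym G q~b) nil))) ≤-refl
  ; x₁≢x₂ = DistGreaterThan⇒≢ G far
  ; y₁≢y₂ = λ a≡b →
      tooShort (cons p~a (cons (subst (λ t → Adj G t q) (sym a≡b) (Adj-sym G q~b)) nil)) (s≤s (s≤s z≤n))
  }
  where
  tooShort : ∀ {k} → Walk G p q k → k ≤ 3 → ⊥
  tooShort p⇝q = <⇒≱ (far _ p⇝q)

lemma2p1 : (n : ℕ) (G : SimpleGraph n) → Connected G →
    (Σ (Fin n) λ p → Σ (Fin n) λ q →
      Pendant G p × Pendant G q × DistGreaterThan G p q 3) →
    Σ (SimpleGraph n) λ G' →
      (degreeSequence G' ↭ degreeSequence G) × TwoComponentsOneIsolatedEdge G'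
lemma2p1 n G connected (p , q , p-pendant , q-pendant , far) =
  let p≢q = DistGreaterThan⇒≢ G far
      (a , p~a) = reachable⇒neighbour G (connected p q) p≢q
      (b , q~b) = reachable⇒neighbour G (connected q p) (≢-sym p≢q)
      s = DistGreaterThan3⇒Switchable p~a q~b far
  in switch s , ↭-reflexive (degreeSequence-switch s) ,
     switch-twoComponentsOneIsolatedEdge s p-pendant q-pendant connected
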